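{- Let $N$ be a finite cyclic group, let $\gamma$ be a generator of $N$, let $x\in N$, and let $a$ be an integer with $a\ge\max(|N|,5)$. Then for some integer $i$ with $1\le i\le\lfloor (a-1)/2\rfloor$ we have $N^2\subseteq\langle \gamma^{ -2i}x\rangle$.
   Context: $N^2=\{y^2: y\in N\}$, the subgroup of squares of $N$. -}

module Defs where

open import Level using (Level)
open import Algebra.Bundles using (Group)
open import Data.Nat using (ℕ; zero; suc)
open import Data.Integer using (ℤ; +_; -[1+_])
open import Data.Fin using (Fin)
open import Data.Product using (∃)
open import Function.Bundles using (Bijection)
import Relation.Binary.PropositionalEquality as ≡

module _ {c ℓ : Level} (G : Group c ℓ) where
  open Group G

  pow : Carrier → ℕ → Carrier
  pow g zero    = ε
  pow g (suc n) = g ∙ pow g n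

  zpow : Carrier → ℤ → Carrier
  zpow g (+ n)      = pow g n
  zpow g -[1+ n ]   = (pow g (suc n)) ⁻¹

  InCyclic : Carrier → Carrier → Set ℓ
  InCyclic g y = ∃ λ (k : ℤ) → y ≈ zpow g k

  Generates : Carrier → Set (c Level.⊔ ℓ)
  Generates g = ∀ y → InCyclic g y

  HasOrder : ℕ → Set (c Level.⊔ ℓ)
  HasOrder n = Bijection (≡.setoid (Fin n)) setoid

  SquaresIn : Carrier → Set (c Level.⊔ ℓ)
  SquaresIn h = ∀ y → InCyclic h (y ∙ y)

module Submission where

-- Let h = γ^(-2i) ∙ x.  Since N is finite, γ has some order
-- d ≤ |N|, so x = γ^r with 0 ≤ r < |N| ≤ a.  We choose i so that the integer
-- r - 2i is ±1 or ±2: take i = 1 for r ∈ {0, 1}, i = 2 for r = 2 (this is where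
-- a ≥ 5 is used) and i = ⌊(r - 1)/2⌋ for r ≥ 3.  Then h = γ^(±e) with e ∣ 2, so
-- γ² is a (non-negative) power of h, and hence so is every square y² = (γ²)^k.

open import Defs
open import Level using (Level)
open import Algebra.Bundles using (Group)
open import Data.Nat using (ℕ; _≤_; _⊔_; _∸_; _/_; _*_; zero; suc; _+_; _<_; s≤s; z≤n)
open import Data.Nat.Properties
open import Data.Nat.DivMod using (m≡m%n+[m/n]*n; m%n<n; m*n/n≡m; /-monoˡ-≤; _%_)
open import Data.Nat.Divisibility using (_∣_; divides; ∣-refl; 1∣_; 0∣⇒≡0)
open import Data.Nat.Solver using (module +-*-Solver)
open import Data.Integer using (-_; +_; -[1+_])
open import Data.Product using (Σ; _×_; _,_)
open import Data.Fin using (Fin; toℕ)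
open import Data.Fin.Properties using (pigeonhole; toℕ<n)
open import Function.Bundles using (Bijection; Surjection)
import Algebra.Properties.Group as GroupProperties
import Algebra.Properties.Monoid.Mult as MonoidMult
import Relation.Binary.Reasoning.Setoid as SetoidReasoning
open import Relation.Binary.PropositionalEquality as ≡ using (_≡_; refl; cong)

open +-*-Solver

data Near (r m : ℕ) : Set where
  above : (e : ℕ) → e ∣ 2 → r ≡ m + e → Near r m
  below : (e : ℕ) → e ∣ 2 → m ≡ r + e → Near r m

divisor-of-2-positive : ∀ {e} → e ∣ 2 → 1 ≤ e
divisor-of-2-positive {zero} 0∣2 with 0∣⇒≡0 0∣2
... | ()
divisor-of-2-positive {suc e} _ = s≤s z≤n

half-bound : ∀ i a → suc (2 * i) ≤ a → i ≤ (a ∸ 1) / 2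
half-bound i a 2i<a = ≡.subst (_≤ (a ∸ 1) / 2) (m*n/n≡m i 2)
  (/-monoˡ-≤ 2 (≡.subst (_≤ a ∸ 1) (*-comm 2 i) (∸-monoˡ-≤ 1 2i<a)))

large-split : ∀ k → Σ ℕ λ j → Σ ℕ λ e → e ∣ 2 × 3 + k ≡ 2 * suc j + e
large-split zero          = 0 , 1 , (1∣ 2) , refl
large-split (suc zero)    = 0 , 2 , ∣-refl , refl
large-split (suc (suc k)) with large-split k
... | j , e , e∣2 , eq = suc j , e , e∣2 , ≡.trans (cong (λ m → 2 + m) eq) (step j e)
  where
  step : ∀ j e → 2 + (2 * suc j + e) ≡ 2 * suc (suc j) + e
  step = solve 2 (λ j e → con 2 :+ (con 2 :* (con 1 :+ j) :+ e)
                         := con 2 :* (con 2 :+ j) :+ e) refl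

3≤5 : 3 ≤ 5
3≤5 = s≤s (s≤s (s≤s z≤n))

choose-shift : ∀ r a → r ≤ a → 5 ≤ a →
  Σ ℕ λ i → (1 ≤ i × i ≤ (a ∸ 1) / 2) × Near r (2 * i)
choose-shift 0 a _ 5≤a = 1 , (s≤s z≤n , half-bound 1 a (≤-trans 3≤5 5≤a)) , below 2 ∣-refl refl
choose-shift 1 a _ 5≤a = 1 , (s≤s z≤n , half-bound 1 a (≤-trans 3≤5 5≤a)) , below 1 (1∣ 2) refl
choose-shift 2 a _ 5≤a = 2 , (s≤s z≤n , half-bound 2 a 5≤a) , below 2 ∣-refl refl
choose-shift (suc (suc (suc k))) a r≤a _ with large-split k
... | j , e , e∣2 , r≡2i+e = suc j , (s≤s z≤n , half-bound (suc j) a 2i<a) , above e e∣2 r≡2i+e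
  where
  2i<a : suc (2 * suc j) ≤ a
  2i<a = ≤-trans (m<m+n (2 * suc j) (divisor-of-2-positive e∣2))
                 (≤-trans (≤-reflexive (≡.sym r≡2i+e)) r≤a)

module Powers {c ℓ : Level} (G : Group c ℓ) where
  open Group G renaming (refl to ≈-refl)
  open GroupProperties G using (inverseʳ-unique; ε⁻¹≈ε; ⁻¹-anti-homo-∙; ∙-cancelˡ)
  open MonoidMult monoid using (×-congʳ; ×-homo-+; ×-assocˡ) renaming (_×_ to _⋆_)
  open SetoidReasoning setoid

  -- pow g n is the n-fold multiple n ⋆ g of the underlying monoid, so the
  -- monoid laws for multiples transfer to it.
  pow≡⋆ : ∀ g n → pow G g n ≡ n ⋆ g
  pow≡⋆ g zero    = refl
  pow≡⋆ g (suc n) = cong (g ∙_) (pow≡⋆ g n)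

  pow-cong : ∀ n {g h} → g ≈ h → pow G g n ≈ pow G h n
  pow-cong n {g} {h} g≈h rewrite pow≡⋆ g n | pow≡⋆ h n = ×-congʳ n g≈h

  pow-+ : ∀ g m n → pow G g (m + n) ≈ pow G g m ∙ pow G g n
  pow-+ g m n rewrite pow≡⋆ g (m + n) | pow≡⋆ g m | pow≡⋆ g n = ×-homo-+ g m n

  pow-* : ∀ g m n → pow G g (m * n) ≈ pow G (pow G g n) m
  pow-* g m n rewrite pow≡⋆ g (m * n) | pow≡⋆ g n | pow≡⋆ (n ⋆ g) m = sym (×-assocˡ g m n)

  pow-ε : ∀ n → pow G ε n ≈ ε
  pow-ε zero    = ≈-refl
  pow-ε (suc n) = trans (identityˡ _) (pow-ε n)

  zpow-neg : ∀ g m → zpow G g (- (+ m)) ≈ pow G g m ⁻¹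
  zpow-neg g zero    = sym ε⁻¹≈ε
  zpow-neg g (suc m) = ≈-refl

  square-pow : ∀ g k → pow G g k ∙ pow G g k ≈ pow G (pow G g 2) k
  square-pow g k = begin
    pow G g k ∙ pow G g k ≈⟨ pow-+ g k k ⟨
    pow G g (k + k)       ≡⟨ cong (pow G g) (solve 1 (λ k → k :+ k := k :* con 2) refl k) ⟩
    pow G g (k * 2)       ≈⟨ pow-* g k 2 ⟩
    pow G (pow G g 2) k   ∎

  pow-periodic : ∀ g d → pow G g d ≈ ε → ∀ r q → pow G g (r + q * d) ≈ pow G g r
  pow-periodic g d gᵈ≈ε r q = begin
    pow G g (r + q * d)           ≈⟨ pow-+ g r (q * d) ⟩
    pow G g r ∙ pow G g (q * d)   ≈⟨ ∙-congˡ (pow-* g q d) ⟩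
    pow G g r ∙ pow G (pow G g d) q ≈⟨ ∙-congˡ (trans (pow-cong q gᵈ≈ε) (pow-ε q)) ⟩
    pow G g r ∙ ε                 ≈⟨ identityʳ _ ⟩
    pow G g r                     ∎

  repetition⇒period : ∀ g i d → pow G g i ≈ pow G g (i + d) → pow G g d ≈ ε
  repetition⇒period g i d repeat = ∙-cancelˡ (pow G g i) _ _ (begin
    pow G g i ∙ pow G g d ≈⟨ pow-+ g i d ⟨
    pow G g (i + d)       ≈⟨ repeat ⟨
    pow G g i             ≈⟨ identityʳ _ ⟨
    pow G g i ∙ ε         ∎)

  period⇒inverse : ∀ g d → pow G g (suc d) ≈ ε → g ⁻¹ ≈ pow G g d
  period⇒inverse g d gᵈ⁺¹≈ε = sym (inverseʳ-unique g (pow G g d) gᵈ⁺¹≈ε)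

  shift-up : ∀ g m e → pow G g m ⁻¹ ∙ pow G g (m + e) ≈ pow G g e
  shift-up g m e = begin
    pow G g m ⁻¹ ∙ pow G g (m + e)           ≈⟨ ∙-congˡ (pow-+ g m e) ⟩
    pow G g m ⁻¹ ∙ (pow G g m ∙ pow G g e)   ≈⟨ assoc _ _ _ ⟨
    (pow G g m ⁻¹ ∙ pow G g m) ∙ pow G g e   ≈⟨ ∙-congʳ (inverseˡ _) ⟩
    ε ∙ pow G g e                            ≈⟨ identityˡ _ ⟩
    pow G g e                                ∎

  shift-down : ∀ g r e → pow G g (r + e) ⁻¹ ∙ pow G g r ≈ pow G g e ⁻¹
  shift-down g r e = begin
    pow G g (r + e) ⁻¹ ∙ pow G g r                  ≈⟨ ∙-congʳ (⁻¹-cong (pow-+ g r e)) ⟩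
    (pow G g r ∙ pow G g e) ⁻¹ ∙ pow G g r          ≈⟨ ∙-congʳ (⁻¹-anti-homo-∙ _ _) ⟩
    (pow G g e ⁻¹ ∙ pow G g r ⁻¹) ∙ pow G g r       ≈⟨ assoc _ _ _ ⟩
    pow G g e ⁻¹ ∙ (pow G g r ⁻¹ ∙ pow G g r)       ≈⟨ ∙-congˡ (inverseˡ _) ⟩
    pow G g e ⁻¹ ∙ ε                                ≈⟨ identityʳ _ ⟩
    pow G g e ⁻¹                                    ∎

  PowerOf : Carrier → Carrier → Set ℓ
  PowerOf h g = Σ ℕ λ p → g ≈ pow G h p

  power-of-power : ∀ {h g} → PowerOf h g → ∀ k → PowerOf h (pow G g k)
  power-of-power {h} {g} (p , g≈hᵖ) k = k * p , (begin
    pow G g k           ≈⟨ pow-cong k g≈hᵖ ⟩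
    pow G (pow G h p) k ≈⟨ pow-* h k p ⟨
    pow G h (k * p)     ∎)

  power-of-divisor : ∀ {h γ e m} → e ∣ m → PowerOf h (pow G γ e) → PowerOf h (pow G γ m)
  power-of-divisor {h} {γ} {e} (divides q refl) γᵉ∈h with power-of-power γᵉ∈h q
  ... | p , [γᵉ]^q≈hᵖ = p , trans (pow-* γ q e) [γᵉ]^q≈hᵖ

module FiniteGroup {c ℓ : Level} (G : Group c ℓ) (n : ℕ) (order : HasOrder G n) where
  open Group G renaming (refl to ≈-refl)
  open GroupProperties G using (⁻¹-involutive)
  open Powers G
  open SetoidReasoning setoid

  power-index : Carrier → Fin (suc n) → Fin n
  power-index g k = Bijection.to⁻ order (pow G g (toℕ k))

  power-index-correct : ∀ g k → Bijection.to order (power-index g k) ≈ pow G g (toℕ k)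
  power-index-correct g k = Surjection.to∘to⁻ (Bijection.surjection order) (pow G g (toℕ k))

  -- Every element has order at most n: among g^0, …, g^n two coincide.
  period : ∀ g → Σ ℕ λ d → suc d ≤ n × pow G g (suc d) ≈ ε
  period g with pigeonhole (n<1+n n) (power-index g)
  ... | i , j , i<j , same-index = d , bound , repetition⇒period g (toℕ i) (suc d) repeat
    where
    d = toℕ j ∸ suc (toℕ i)
    j≡i+d+1 : toℕ i + suc d ≡ toℕ j
    j≡i+d+1 = ≡.trans (+-suc (toℕ i) d) (m+[n∸m]≡n i<j)
    bound : suc d ≤ n
    bound = ≤-trans (≤-trans (m≤n+m (suc d) (toℕ i)) (≤-reflexive j≡i+d+1)) (≤-pred (toℕ<n j))
    repeat : pow G g (toℕ i) ≈ pow G g (toℕ i + suc d)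
    repeat = begin
      pow G g (toℕ i)                      ≈⟨ power-index-correct g i ⟨
      Bijection.to order (power-index g i) ≡⟨ cong (Bijection.to order) same-index ⟩
      Bijection.to order (power-index g j) ≈⟨ power-index-correct g j ⟩
      pow G g (toℕ j)                      ≡⟨ cong (pow G g) (≡.sym j≡i+d+1) ⟩
      pow G g (toℕ i + suc d)              ∎

  inverse-power : ∀ g → PowerOf g (g ⁻¹)
  inverse-power g with period g
  ... | d , _ , gᵈ⁺¹≈ε = d , period⇒inverse g d gᵈ⁺¹≈ε

  zpow-power : ∀ g t → PowerOf g (zpow G g t)
  zpow-power g (+ k)     = k , ≈-refl
  zpow-power g -[1+ m ] with inverse-power (pow G g (suc m))
  ... | p , inverse≈ = p * suc m , trans inverse≈ (sym (pow-* g p (suc m)))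

  small-exponent : ∀ γ → Generates G γ → ∀ y → Σ ℕ λ r → r < n × y ≈ pow G γ r
  small-exponent γ generates y with generates y | period γ
  ... | t , y≈γᵗ | d , d<n , γᵈ⁺¹≈ε with zpow-power γ t
  ... | k , γᵗ≈γᵏ = k % suc d , ≤-trans (m%n<n k (suc d)) d<n , (begin
    y                                     ≈⟨ trans y≈γᵗ γᵗ≈γᵏ ⟩
    pow G γ k                             ≡⟨ cong (pow G γ) (m≡m%n+[m/n]*n k (suc d)) ⟩
    pow G γ (k % suc d + k / suc d * suc d) ≈⟨ pow-periodic γ (suc d) γᵈ⁺¹≈ε (k % suc d) (k / suc d) ⟩
    pow G γ (k % suc d)                   ∎)

  -- If h = (γ^m)⁻¹ γ^r with r and m near each other, then h = γ^(±e) with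
  -- e ∣ 2, so γ² is a power of h.
  square-power-of-shift : ∀ {γ h r m} → Near r m → h ≈ pow G γ m ⁻¹ ∙ pow G γ r →
    PowerOf h (pow G γ 2)
  square-power-of-shift {γ} {h} {m = m} (above e e∣2 refl) h≈ =
    power-of-divisor e∣2 (1 , (begin
      pow G γ e                         ≈⟨ shift-up γ m e ⟨
      pow G γ m ⁻¹ ∙ pow G γ (m + e)    ≈⟨ h≈ ⟨
      h                                 ≈⟨ identityʳ h ⟨
      h ∙ ε                             ∎))
  square-power-of-shift {γ} {h} {r = r} (below e e∣2 refl) h≈ with inverse-power h
  ... | p , h⁻¹≈hᵖ = power-of-divisor e∣2 (p , (begin
      pow G γ e                         ≈⟨ ⁻¹-involutive _ ⟨
      pow G γ e ⁻¹ ⁻¹                   ≈⟨ ⁻¹-cong (trans h≈ (shift-down γ r e)) ⟨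
      h ⁻¹                              ≈⟨ h⁻¹≈hᵖ ⟩
      pow G h p                         ∎))

  squares-in : ∀ γ → Generates G γ → ∀ {h} → PowerOf h (pow G γ 2) → SquaresIn G h
  squares-in γ generates {h} γ²∈h y with small-exponent γ generates y
  ... | k , _ , y≈γᵏ with power-of-power γ²∈h k
  ... | p , [γ²]ᵏ≈hᵖ = + p , (begin
      y ∙ y                   ≈⟨ ∙-cong y≈γᵏ y≈γᵏ ⟩
      pow G γ k ∙ pow G γ k   ≈⟨ square-pow γ k ⟩
      pow G (pow G γ 2) k     ≈⟨ [γ²]ᵏ≈hᵖ ⟩
      pow G h p               ∎)

lemma3p8 : {c ℓ : Level} (N : Group c ℓ) (n : ℕ) → HasOrder N n →
    (γ : Group.Carrier N) → Generates N γ → (x : Group.Carrier N) →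
    (a : ℕ) → n ⊔ 5 ≤ a →
    Σ ℕ (λ i → (1 ≤ i × i ≤ (a ∸ 1) / 2) ×
    SquaresIn N (Group._∙_ N (zpow N γ (- (+ (2 * i)))) x))
lemma3p8 N n order γ generates x a n⊔5≤a =
  let open Group N
      open Powers N
      open FiniteGroup N n order
      (r , r<n , x≈γʳ) = small-exponent γ generates x
      r≤a = ≤-trans (<⇒≤ r<n) (≤-trans (m≤m⊔n n 5) n⊔5≤a)
      (i , i-bounds , near) = choose-shift r a r≤a (≤-trans (m≤n⊔m n 5) n⊔5≤a)
      h≈γ⁻²ⁱγʳ = ∙-cong (zpow-neg γ (2 * i)) x≈γʳ
  in i , i-bounds , squares-in γ generates (square-power-of-shift near h≈γ⁻²ⁱγʳ)
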